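{- If $w$ is a pre-$5/4$-power-free subscript-increasing word over $\Sigma_8$, then $\varphi(w)$ contains no factor that is a $5/4$-power of length greater than or equal to $30$.
   Context: Let $\Sigma_8=\{n_j : n\in\mathbb{Z},\ 0\le j\le 7\}$ be the infinite alphabet of distinct formal symbols $n_j$. Let $\varphi$ be the $6$-uniform morphism on $\Sigma_8$ (extended to finite and infinite words by concatenation) defined for all $n\in\mathbb{Z}$ by $\varphi(n_0)=0_0 1_1 0_2 0_3 1_4 (n+3)_5$, $\varphi(n_1)=1_6 1_7 0_0 0_1 0_2 (n+2)_3$, $\varphi(n_2)=1_4 1_5 1_6 0_7 0_0 (n+3)_1$, $\varphi(n_3)=0_2 1_3 1_4 0_5 1_6 (n+2)_7$, $\varphi(n_4)=0_0 1_1 0_2 0_3 1_4 (n+1)_5$, $\varphi(n_5)=1_6 1_7 0_0 0_1 0_2 (n+2)_3$, $\varphi(n_6)=1_4 1_5 1_6 0_7 0_0 (n+1)_1$, $\varphi(n_7)=0_2 1_3 1_4 0_5 1_6 (n+2)_7$. A word over $\Sigma_8$ is subscript-increasing if the subscripts of consecutive letters increase by $1$ modulo $8$. A $5/4$-power is a word $xyx$ with $|x|\ge1$ and $|y|=3|x|$. A word $v$ over $\Sigma_8$ is a pre-$5/4$-power if $\varphi(v)$ is a $5/4$-power; a word is pre-$5/4$-power-free if none of its factors is a pre-$5/4$-power. -}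

module Defs where

open import Data.Integer using (ℤ; +_; _+_)
open import Data.Fin using (Fin; zero; suc; toℕ)
open import Data.Nat using (ℕ; _*_; _≥_) renaming (suc to nsuc; _+_ to _+ℕ_)
open import Data.Nat.DivMod using (_%_)
open import Data.Product using (_×_; _,_; Σ; ∃; ∃-syntax; proj₂)
open import Data.List using (List; []; _∷_; _++_; length; concatMap)
open import Data.Unit using (⊤)
open import Relation.Binary.PropositionalEquality using (_≡_)
open import Relation.Nullary using (¬_)

-- The letter n_j is represented as the pair (n , j).
Letter : Set
Letter = ℤ × Fin 8

Word : Set
Word = List Letter

l : ℕ → Fin 8 → Letter
l i j = (+ i , j)

φ₁ : Letter → Word
φ₁ (n , zero) =
  l 0 zero ∷ l 1 (suc zero) ∷ l 0 (suc (suc zero)) ∷ l 0 (suc (suc (suc zero))) ∷ l 1 (suc (suc (suc (suc zero)))) ∷ (n + + 3 , suc (suc (suc (suc (suc zero))))) ∷ []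
φ₁ (n , suc zero) =
  l 1 (suc (suc (suc (suc (suc (suc zero)))))) ∷ l 1 (suc (suc (suc (suc (suc (suc (suc zero))))))) ∷ l 0 zero ∷ l 0 (suc zero) ∷ l 0 (suc (suc zero)) ∷ (n + + 2 , suc (suc (suc zero))) ∷ []
φ₁ (n , suc (suc zero)) =
  l 1 (suc (suc (suc (suc zero)))) ∷ l 1 (suc (suc (suc (suc (suc zero))))) ∷ l 1 (suc (suc (suc (suc (suc (suc zero)))))) ∷ l 0 (suc (suc (suc (suc (suc (suc (suc zero))))))) ∷ l 0 zero ∷ (n + + 3 , suc zero) ∷ []
φ₁ (n , suc (suc (suc zero))) =
  l 0 (suc (suc zero)) ∷ l 1 (suc (suc (suc zero))) ∷ l 1 (suc (suc (suc (suc zero)))) ∷ l 0 (suc (suc (suc (suc (suc zero))))) ∷ l 1 (suc (suc (suc (suc (suc (suc zero)))))) ∷ (n + + 2 , suc (suc (suc (suc (suc (suc (suc zero))))))) ∷ []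
φ₁ (n , suc (suc (suc (suc zero)))) =
  l 0 zero ∷ l 1 (suc zero) ∷ l 0 (suc (suc zero)) ∷ l 0 (suc (suc (suc zero))) ∷ l 1 (suc (suc (suc (suc zero)))) ∷ (n + + 1 , suc (suc (suc (suc (suc zero))))) ∷ []
φ₁ (n , suc (suc (suc (suc (suc zero))))) =
  l 1 (suc (suc (suc (suc (suc (suc zero)))))) ∷ l 1 (suc (suc (suc (suc (suc (suc (suc zero))))))) ∷ l 0 zero ∷ l 0 (suc zero) ∷ l 0 (suc (suc zero)) ∷ (n + + 2 , suc (suc (suc zero))) ∷ []
φ₁ (n , suc (suc (suc (suc (suc (suc zero)))))) =
  l 1 (suc (suc (suc (suc zero)))) ∷ l 1 (suc (suc (suc (suc (suc zero))))) ∷ l 1 (suc (suc (suc (suc (suc (suc zero)))))) ∷ l 0 (suc (suc (suc (suc (suc (suc (suc zero))))))) ∷ l 0 zero ∷ (n + + 1 , suc zero) ∷ []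
φ₁ (n , suc (suc (suc (suc (suc (suc (suc zero))))))) =
  l 0 (suc (suc zero)) ∷ l 1 (suc (suc (suc zero))) ∷ l 1 (suc (suc (suc (suc zero)))) ∷ l 0 (suc (suc (suc (suc (suc zero))))) ∷ l 1 (suc (suc (suc (suc (suc (suc zero)))))) ∷ (n + + 2 , suc (suc (suc (suc (suc (suc (suc zero))))))) ∷ []

φ : Word → Word
φ = concatMap φ₁

SubscriptIncreasing : Word → Set
SubscriptIncreasing []                      = ⊤
SubscriptIncreasing (a ∷ [])                = ⊤
SubscriptIncreasing ((n , i) ∷ (m , j) ∷ w) =
  (toℕ j ≡ (nsuc (toℕ i)) % 8) × SubscriptIncreasing ((m , j) ∷ w)

Factor : Word → Word → Set
Factor u w = ∃[ p ] ∃[ s ] (w ≡ p ++ u ++ s)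

Is5/4Power : Word → Set
Is5/4Power z = ∃[ x ] ∃[ y ] (length x ≥ 1 × length y ≡ 3 * length x × z ≡ x ++ y ++ x)

IsPre5/4Power : Word → Set
IsPre5/4Power v = Is5/4Power (φ v)

Pre5/4PowerFree : Word → Set
Pre5/4PowerFree w = ∀ v → Factor v w → ¬ IsPre5/4Power v

module Submission where

-- For subscript-increasing w, label each position of φ(w) by its state: its offset inside the
-- φ-block it belongs to (mod 6) and the subscript of its letter (mod 8). Both advance by one from
-- each position to the next, so the states have exact period 24, and at offsets 0–4 the state
-- determines the letter, as the first five letters of φ(n_j) do not depend on n. A finite check
-- shows that six consecutive letters determine the state of the first one. If z = xyx with |x| ≥ 6
-- is a factor of φ(w), both occurrences of x therefore start in the same state, so 24 ∣ 4|x|, i.e.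
-- 6 ∣ |x|. Moving z back to the start of its block keeps it a 5/4-power, because the letters in
-- front of either occurrence of x inside its block are determined by the same states; the moved
-- power is φ(v) for a factor v of w, which is impossible if w is pre-5/4-power-free.

open import Defs
open import Data.Nat using (_≥_)
open import Data.List using (length)
open import Relation.Nullary using (¬_)

open import Data.Empty using (⊥)
open import Data.Fin using (Fin; toℕ)
open import Data.Fin.Patterns
open import Data.Fin.Properties using (all?; toℕ-fromℕ<; toℕ-injective) renaming (_≟_ to _≟ᶠ_)
open import Data.Integer using (ℤ; +_)
open import Data.Integer.Properties using () renaming (_≟_ to _≟ℤ_)
open import Data.List using (List; []; _∷_; _++_)
open import Data.List.Properties using (∷-injective; ++-assoc; length-++; ++-monoid)
open import Data.Nat using (zero; suc; _+_; _*_; _∸_; _≤_; _<_; _<?_; s≤s; z≤n)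
open import Data.Nat.DivMod using (_mod_; _%_; _/_; m%n<n; m≡m%n+[m/n]*n; m<n⇒m%n≡m)
open import Data.Nat.Divisibility using (_∣_; divides; m%n≡0⇒n∣m; *-cancelˡ-∣; *-monoʳ-∣)
open import Data.Nat.GeneralisedArithmetic using (iterate)
open import Data.Nat.Properties
  using (_≟_; allUpTo?; ≤-trans; <-≤-trans; <⇒≤; ≤-pred; ≮⇒≥; m<m+n; m≤m+n; m∸n+n≡m;
         +-suc; +-comm; +-assoc; +-cancelˡ-≡; *-assoc; *-cancelˡ-≤; suc-injective)
open import Data.Product using (_×_; _,_; ∃-syntax; proj₁; proj₂)
open import Data.Product.Properties using (≡-dec)
open import Data.Unit using (⊤; tt)
open import Function using (case_of_)
open import Relation.Binary.Definitions using (DecidableEquality)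
open import Relation.Binary.PropositionalEquality
open import Relation.Nullary using (Dec; yes; no; _→-dec_; contradiction)
open import Relation.Nullary.Decidable using (map′; toWitness)
open import Tactic.MonoidSolver using (solve)

next : ∀ {n} → Fin (suc n) → Fin (suc n)
next {n} i = suc (toℕ i) mod suc n

toℕ-next : ∀ {n} (i : Fin (suc n)) → toℕ i < n → toℕ (next i) ≡ suc (toℕ i)
toℕ-next {n} i i<n = trans (toℕ-fromℕ< _) (m<n⇒m%n≡m (s≤s i<n))

iterate-+ : ∀ {A : Set} (f : A → A) x m n → iterate f x (m + n) ≡ iterate f (iterate f x m) n
iterate-+ f x zero    n = refl
iterate-+ f x (suc m) n = iterate-+ f (f x) m n

iterate-periodic : ∀ {A : Set} (f : A → A) n → (∀ x → iterate f x n ≡ x) →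
  ∀ q x → iterate f x (q * n) ≡ x
iterate-periodic f n per zero    x = refl
iterate-periodic f n per (suc q) x = begin
  iterate f x (n + q * n)           ≡⟨ iterate-+ f x n (q * n) ⟩
  iterate f (iterate f x n) (q * n) ≡⟨ cong (λ y → iterate f y (q * n)) (per x) ⟩
  iterate f x (q * n)               ≡⟨ iterate-periodic f n per q x ⟩
  x                                 ∎
  where open ≡-Reasoning

prefix-of-++ : ∀ {A : Set} (a : List A) {b c d} → a ++ b ≡ c ++ d → length a ≤ length c →
  ∃[ t ] (c ≡ a ++ t × b ≡ t ++ d)
prefix-of-++ []      eq _ = _ , refl , eq
prefix-of-++ (x ∷ a) {c = y ∷ c} eq (s≤s a≤c) with ∷-injective eq
... | refl , eq′ = let t , c≡ , b≡ = prefix-of-++ a eq′ a≤c in t , cong (x ∷_) c≡ , b≡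

split-at-length : ∀ {A : Set} (xs : List A) m {n} → length xs ≡ m + n →
  ∃[ a ] ∃[ b ] (xs ≡ a ++ b × length a ≡ m × length b ≡ n)
split-at-length xs       zero    eq = [] , xs , refl , refl , eq
split-at-length (x ∷ xs) (suc m) eq =
  let a , b , xs≡ , |a| , |b| = split-at-length xs m (suc-injective eq)
  in x ∷ a , b , cong (x ∷_) xs≡ , cong suc |a| , |b|

length-++-swap : ∀ {A : Set} (a b : List A) {a′} → length a ≡ length a′ → length (a ++ b) ≡ length (b ++ a′)
length-++-swap a b {a′} |a| = begin
  length (a ++ b)      ≡⟨ length-++ a ⟩
  length a + length b  ≡⟨ cong (_+ length b) |a| ⟩
  length a′ + length b ≡⟨ +-comm (length a′) (length b) ⟩
  length b + length a′ ≡⟨ length-++ b ⟨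
  length (b ++ a′)     ∎
  where open ≡-Reasoning

State : Set
State = Fin 6 × Fin 8

step : State → State
step (p , s) = next p , next s

_≟ˢ_ : DecidableEquality State
_≟ˢ_ = ≡-dec _≟ᶠ_ _≟ᶠ_

∀-state? : {P : State → Set} → (∀ σ → Dec (P σ)) → Dec (∀ σ → P σ)
∀-state? P? = map′ (λ h (p , s) → h p s) (λ h p s → h (p , s)) (all? λ p → all? λ s → P? (p , s))

data Constraint : Set where
  unconstrained : Constraint
  exactly       : ℤ → Constraint
  impossible    : Constraint

Fits : Constraint → ℤ → Set
Fits unconstrained _ = ⊤
Fits (exactly u)   v = u ≡ v
Fits impossible    _ = ⊥

-- The value of a letter of φ(w) with offset p and subscript s, read off from the definition of φ.
-- At offset 5 the value depends on the preimage letter; a subscript of the wrong parity cannot occur.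
constraint : Fin 6 → Fin 8 → Constraint
constraint 0F 0F = exactly (+ 0)
constraint 0F 2F = exactly (+ 0)
constraint 0F 4F = exactly (+ 1)
constraint 0F 6F = exactly (+ 1)
constraint 1F 1F = exactly (+ 1)
constraint 1F 3F = exactly (+ 1)
constraint 1F 5F = exactly (+ 1)
constraint 1F 7F = exactly (+ 1)
constraint 2F 0F = exactly (+ 0)
constraint 2F 2F = exactly (+ 0)
constraint 2F 4F = exactly (+ 1)
constraint 2F 6F = exactly (+ 1)
constraint 3F 1F = exactly (+ 0)
constraint 3F 3F = exactly (+ 0)
constraint 3F 5F = exactly (+ 0)
constraint 3F 7F = exactly (+ 0)
constraint 4F 0F = exactly (+ 0)
constraint 4F 2F = exactly (+ 0)
constraint 4F 4F = exactly (+ 1)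
constraint 4F 6F = exactly (+ 1)
constraint 5F _  = unconstrained
constraint _  _  = impossible

Admissible : State → Letter → Set
Admissible (p , s) (v , s′) = s′ ≡ s × Fits (constraint p s) v

Conforms : State → Word → Set
Conforms σ []      = ⊤
Conforms σ (c ∷ u) = Admissible σ c × Conforms (step σ) u

Compatible : State → State → Set
Compatible σ σ′ = ∃[ c ] (Admissible σ c × Admissible σ′ c)

Overlap : Constraint → Constraint → Set
Overlap A B = ∃[ v ] (Fits A v × Fits B v)

overlap? : ∀ A B → Dec (Overlap A B)
overlap? unconstrained unconstrained = yes (+ 0 , tt , tt)
overlap? unconstrained (exactly v)   = yes (v , tt , refl)
overlap? (exactly u)   unconstrained = yes (u , refl , tt)
overlap? (exactly u)   (exactly v) with u ≟ℤ v
... | yes refl = yes (u , refl , refl)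
... | no u≢v   = no λ { (_ , refl , refl) → u≢v refl }
overlap? impossible    _             = no λ { (_ , () , _) }
overlap? unconstrained impossible    = no λ { (_ , _ , ()) }
overlap? (exactly _)   impossible    = no λ { (_ , _ , ()) }

compatible? : ∀ σ σ′ → Dec (Compatible σ σ′)
compatible? (p , s) (p′ , s′) with s ≟ᶠ s′ | overlap? (constraint p s) (constraint p′ s′)
... | no s≢s′  | _                = no λ { (_ , (refl , _) , (refl , _)) → s≢s′ refl }
... | yes refl | yes (v , f , f′) = yes ((v , s) , (refl , f) , (refl , f′))
... | yes refl | no ¬overlap      = no λ { ((v , _) , (refl , f) , (_ , f′)) → ¬overlap (v , f , f′) }

Determinate : Constraint → Set
Determinate A = ∀ {v v′} → Fits A v → Fits A v′ → v ≡ v′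

determinate? : ∀ A → Dec (Determinate A)
determinate? unconstrained = no λ d → case d {+ 0} {+ 1} tt tt of λ ()
determinate? (exactly u)   = yes λ { refl refl → refl }
determinate? impossible    = yes λ ()

-- φ(n_j) starts with the subscript −2j mod 8.
blockStart : Fin 8 → Fin 8
blockStart j = (6 * toℕ j) mod 8

states-separated : ∀ σ σ′ → (∀ {t} → t < 6 → Compatible (iterate step σ t) (iterate step σ′ t)) → σ ≡ σ′
states-separated = toWitness {a? = ∀-state? λ σ → ∀-state? λ σ′ →
  allUpTo? (λ t → compatible? (iterate step σ t) (iterate step σ′ t)) 6 →-dec σ ≟ˢ σ′} tt

step-period : ∀ σ → iterate step σ 24 ≡ σ
step-period = toWitness {a? = ∀-state? λ σ → iterate step σ 24 ≟ˢ σ} tt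

step-aperiodic : ∀ σ {r} → r < 24 → iterate step σ r ≡ σ → r ≡ 0
step-aperiodic = toWitness {a? = ∀-state? λ σ → allUpTo? (λ r → iterate step σ r ≟ˢ σ →-dec r ≟ 0) 24} tt

constraint-determinate : ∀ p s → toℕ p < 5 → Determinate (constraint p s)
constraint-determinate = toWitness {a? = all? λ p → all? λ s → toℕ p <? 5 →-dec determinate? (constraint p s)} tt

blockStart-next : ∀ j → iterate step (0F , blockStart j) 6 ≡ (0F , blockStart (next j))
blockStart-next = toWitness {a? = all? λ j → iterate step (0F , blockStart j) 6 ≟ˢ (0F , blockStart (next j))} tt

step-24-periodic : ∀ q σ → iterate step σ (q * 24) ≡ σ
step-24-periodic = iterate-periodic step 24 step-period

step-iterate-fixed⇒24∣ : ∀ σ n → iterate step σ n ≡ σ → 24 ∣ n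
step-iterate-fixed⇒24∣ σ n fixed = m%n≡0⇒n∣m n 24 (step-aperiodic σ (m%n<n n 24) fixed′)
  where
  open ≡-Reasoning
  fixed′ : iterate step σ (n % 24) ≡ σ
  fixed′ = begin
    iterate step σ (n % 24)                              ≡⟨ step-24-periodic (n / 24) _ ⟨
    iterate step (iterate step σ (n % 24)) (n / 24 * 24) ≡⟨ iterate-+ step σ (n % 24) (n / 24 * 24) ⟨
    iterate step σ (n % 24 + n / 24 * 24)                ≡⟨ cong (iterate step σ) (m≡m%n+[m/n]*n n 24) ⟨
    iterate step σ n                                     ≡⟨ fixed ⟩
    σ                                                    ∎

24∣⇒step-iterate-fixed : ∀ σ {n} → 24 ∣ n → iterate step σ n ≡ σ
24∣⇒step-iterate-fixed σ (divides q refl) = step-24-periodic q σ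

conforms-++⁻ : ∀ {σ} u {v} → Conforms σ (u ++ v) → Conforms σ u × Conforms (iterate step σ (length u)) v
conforms-++⁻ []      cv        = tt , cv
conforms-++⁻ (c ∷ u) (a , cuv) = let cu , cv = conforms-++⁻ u cuv in (a , cu) , cv

conforms-++⁺ : ∀ {σ} u {v} → Conforms σ u → Conforms (iterate step σ (length u)) v → Conforms σ (u ++ v)
conforms-++⁺ []      _        cv = cv
conforms-++⁺ (c ∷ u) (a , cu) cv = a , conforms-++⁺ u cu cv

conforms-compatible : ∀ {σ σ′} u → Conforms σ u → Conforms σ′ u →
  ∀ {t} → t < length u → Compatible (iterate step σ t) (iterate step σ′ t)
conforms-compatible (c ∷ u) (a , _)  (a′ , _)  {zero}  _        = c , a , a′
conforms-compatible (c ∷ u) (_ , cu) (_ , cu′) {suc t} (s≤s t<) = conforms-compatible u cu cu′ t<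

conforms-determines-state : ∀ {σ σ′} u → 6 ≤ length u → Conforms σ u → Conforms σ′ u → σ ≡ σ′
conforms-determines-state {σ} {σ′} u 6≤|u| cu cu′ =
  states-separated σ σ′ λ t<6 → conforms-compatible u cu cu′ (<-≤-trans t<6 6≤|u|)

admissible-unique : ∀ {p s c c′} → toℕ p < 5 → Admissible (p , s) c → Admissible (p , s) c′ → c ≡ c′
admissible-unique {p} {s} p<5 (refl , f) (refl , f′) = cong (_, s) (constraint-determinate p s p<5 f f′)

conforms-unique : ∀ {p s} u u′ → length u ≡ length u′ → toℕ p + length u ≤ 5 →
  Conforms (p , s) u → Conforms (p , s) u′ → u ≡ u′
conforms-unique     []      []        _   _     _        _          = refl
conforms-unique {p} (c ∷ u) (c′ ∷ u′) len bound (a , cu) (a′ , cu′) =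
  cong₂ _∷_ (admissible-unique p<5 a a′) (conforms-unique u u′ (suc-injective len) bound′ cu cu′)
  where
  p<5 : toℕ p < 5
  p<5 = <-≤-trans (m<m+n (toℕ p) (s≤s z≤n)) bound
  bound′ : toℕ (next p) + length u ≤ 5
  bound′ = subst (_≤ 5) (trans (+-suc (toℕ p) (length u)) (cong (_+ length u) (sym (toℕ-next p p<5)))) bound

conforms-block-prefix-recurs : ∀ {s} p u p′ v → 24 ∣ length (p ++ u) → length p′ ≡ length p → length p < 6 →
  Conforms (0F , s) (p ++ u ++ p′ ++ v) → p′ ≡ p
conforms-block-prefix-recurs {s} p u p′ v 24∣ |p′| p<6 conf =
  conforms-unique p′ p |p′| (subst (_≤ 5) (sym |p′|) (≤-pred p<6)) p′-conforms (proj₁ (conforms-++⁻ p conf))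
  where
  p′-conforms : Conforms (0F , s) p′
  p′-conforms = proj₁ (conforms-++⁻ p′ (subst (λ σ → Conforms σ (p′ ++ v)) (24∣⇒step-iterate-fixed (0F , s) 24∣)
    (proj₂ (conforms-++⁻ (p ++ u) (subst (Conforms (0F , s)) (sym (++-assoc p u _)) conf)))))

length-φ₁ : ∀ c → length (φ₁ c) ≡ 6
length-φ₁ (_ , 0F) = refl
length-φ₁ (_ , 1F) = refl
length-φ₁ (_ , 2F) = refl
length-φ₁ (_ , 3F) = refl
length-φ₁ (_ , 4F) = refl
length-φ₁ (_ , 5F) = refl
length-φ₁ (_ , 6F) = refl
length-φ₁ (_ , 7F) = refl

φ₁-conforms : ∀ c → Conforms (0F , blockStart (proj₂ c)) (φ₁ c)
φ₁-conforms (_ , 0F) = (refl , refl) , (refl , refl) , (refl , refl) , (refl , refl) , (refl , refl) , (refl , tt) , tt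
φ₁-conforms (_ , 1F) = (refl , refl) , (refl , refl) , (refl , refl) , (refl , refl) , (refl , refl) , (refl , tt) , tt
φ₁-conforms (_ , 2F) = (refl , refl) , (refl , refl) , (refl , refl) , (refl , refl) , (refl , refl) , (refl , tt) , tt
φ₁-conforms (_ , 3F) = (refl , refl) , (refl , refl) , (refl , refl) , (refl , refl) , (refl , refl) , (refl , tt) , tt
φ₁-conforms (_ , 4F) = (refl , refl) , (refl , refl) , (refl , refl) , (refl , refl) , (refl , refl) , (refl , tt) , tt
φ₁-conforms (_ , 5F) = (refl , refl) , (refl , refl) , (refl , refl) , (refl , refl) , (refl , refl) , (refl , tt) , tt
φ₁-conforms (_ , 6F) = (refl , refl) , (refl , refl) , (refl , refl) , (refl , refl) , (refl , refl) , (refl , tt) , tt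
φ₁-conforms (_ , 7F) = (refl , refl) , (refl , refl) , (refl , refl) , (refl , refl) , (refl , refl) , (refl , tt) , tt

next-subscript : ∀ (i j : Fin 8) → toℕ j ≡ suc (toℕ i) % 8 → j ≡ next i
next-subscript i j j≡ = toℕ-injective (trans j≡ (sym (toℕ-fromℕ< (m%n<n (suc (toℕ i)) 8))))

subscriptIncreasing-tail : ∀ c w → SubscriptIncreasing (c ∷ w) → SubscriptIncreasing w
subscriptIncreasing-tail _ []      _        = tt
subscriptIncreasing-tail _ (_ ∷ _) (_ , si) = si

subscriptIncreasing-++ʳ : ∀ u {w} → SubscriptIncreasing (u ++ w) → SubscriptIncreasing w
subscriptIncreasing-++ʳ []      si = si
subscriptIncreasing-++ʳ (c ∷ u) si = subscriptIncreasing-++ʳ u (subscriptIncreasing-tail c (u ++ _) si)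

φ-∷-conforms : ∀ n j w → SubscriptIncreasing ((n , j) ∷ w) → Conforms (0F , blockStart j) (φ ((n , j) ∷ w))
φ-∷-conforms n j w si = conforms-++⁺ (φ₁ (n , j)) (φ₁-conforms (n , j))
  (subst (λ σ → Conforms σ (φ w)) (sym next-block) (rest w si))
  where
  next-block : iterate step (0F , blockStart j) (length (φ₁ (n , j))) ≡ (0F , blockStart (next j))
  next-block = trans (cong (iterate step _) (length-φ₁ (n , j))) (blockStart-next j)
  rest : ∀ w → SubscriptIncreasing ((n , j) ∷ w) → Conforms (0F , blockStart (next j)) (φ w)
  rest []             _  = tt
  rest ((m , j′) ∷ w) si = subst (λ k → Conforms (0F , blockStart k) (φ ((m , j′) ∷ w)))
    (next-subscript j j′ (proj₁ si)) (φ-∷-conforms m j′ w (proj₂ si))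

φ-conforms : ∀ w → SubscriptIncreasing w → ∃[ s ] Conforms (0F , s) (φ w)
φ-conforms []            _  = 0F , tt
φ-conforms ((n , j) ∷ w) si = blockStart j , φ-∷-conforms n j w si

φ-split-block-aligned : ∀ w p r → φ w ≡ p ++ r →
  ∃[ u ] ∃[ w₁ ] ∃[ p′ ] (w ≡ u ++ w₁ × φ w₁ ≡ p′ ++ r × length p′ < 6)
φ-split-block-aligned w p r eq with length p <? 6
... | yes p<6 = [] , w , p , refl , eq , p<6
φ-split-block-aligned []      []      r eq | no p≮6 = contradiction (s≤s z≤n) p≮6
φ-split-block-aligned (c ∷ w) p       r eq | no p≮6
  with prefix-of-++ (φ₁ c) {c = p} eq (subst (_≤ length p) (sym (length-φ₁ c)) (≮⇒≥ p≮6))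
... | t , refl , eq′ =
  let u , w₁ , p′ , w≡ , eq₁ , p′<6 = φ-split-block-aligned w t r eq′
  in c ∷ u , w₁ , p′ , cong (c ∷_) w≡ , eq₁ , p′<6

φ-block-prefix-preimage : ∀ n w t r → length t ≡ n * 6 → φ w ≡ t ++ r →
  ∃[ v ] ∃[ w₂ ] (w ≡ v ++ w₂ × φ v ≡ t)
φ-block-prefix-preimage zero    w       []      r _   _  = [] , w , refl , refl
φ-block-prefix-preimage (suc n) []      (_ ∷ _) r _   ()
φ-block-prefix-preimage (suc n) (c ∷ w) t       r |t| eq
  with prefix-of-++ (φ₁ c) {c = t} eq (subst (_≤ length t) (sym (length-φ₁ c)) (subst (6 ≤_) (sym |t|) (m≤m+n 6 (n * 6))))
... | t′ , refl , eq′ =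
  let v , w₂ , w≡ , φv≡ = φ-block-prefix-preimage n w t′ r |t′| eq′
  in c ∷ v , w₂ , cong (c ∷_) w≡ , cong (φ₁ c ++_) φv≡
  where
  |t′| : length t′ ≡ n * 6
  |t′| = +-cancelˡ-≡ 6 _ _ (trans (trans (cong (_+ length t′) (sym (length-φ₁ c))) (sym (length-++ (φ₁ c)))) |t|)

length-5/4-power : ∀ (x y : Word) → length y ≡ 3 * length x → length (x ++ y ++ x) ≡ 5 * length x
length-5/4-power x y |y| = begin
  length (x ++ y ++ x)                 ≡⟨ length-++ x ⟩
  length x + length (y ++ x)           ≡⟨ cong (λ n → length x + n) (length-++ y) ⟩
  length x + (length y + length x)     ≡⟨ cong (λ n → length x + (n + length x)) |y| ⟩
  length x + (3 * length x + length x) ≡⟨ cong (λ n → length x + n) (+-comm (3 * length x) (length x)) ⟩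
  5 * length x                         ∎
  where open ≡-Reasoning

φ-5/4-power-prefix-preimage : ∀ w X Y r → length Y ≡ 3 * length X → 6 ∣ length X → φ w ≡ (X ++ Y ++ X) ++ r →
  ∃[ v ] ∃[ w′ ] (w ≡ v ++ w′ × φ v ≡ X ++ Y ++ X)
φ-5/4-power-prefix-preimage w X Y r |Y| (divides m |X|≡) = φ-block-prefix-preimage (5 * m) w (X ++ Y ++ X) r
  (trans (length-5/4-power X Y |Y|) (trans (cong (5 *_) |X|≡) (sym (*-assoc 5 m 6))))

conforming-5/4-power-6∣ : ∀ {σ} x y → length y ≡ 3 * length x → 6 ≤ length x →
  Conforms σ (x ++ y ++ x) → 6 ∣ length x
conforming-5/4-power-6∣ {σ} x y |y| 6≤|x| conf =
  *-cancelˡ-∣ {6} 4 (step-iterate-fixed⇒24∣ σ (4 * length x) (sym same-state))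
  where
  split : Conforms σ (x ++ y) × Conforms (iterate step σ (length (x ++ y))) x
  split = conforms-++⁻ (x ++ y) (subst (Conforms σ) (sym (++-assoc x y x)) conf)
  |x++y| : length (x ++ y) ≡ 4 * length x
  |x++y| = trans (length-++ x) (cong (λ n → length x + n) |y|)
  same-state : σ ≡ iterate step σ (4 * length x)
  same-state = conforms-determines-state x 6≤|x| (proj₁ (conforms-++⁻ x (proj₁ split)))
    (subst (λ n → Conforms (iterate step σ n) x) |x++y| (proj₂ split))

shift-to-block-start : ∀ {s} p x y r → length p < 6 → 6 ≤ length x → 6 ∣ length x → length y ≡ 3 * length x →
  Conforms (0F , s) (p ++ (x ++ y ++ x) ++ r) →
  ∃[ X ] ∃[ Y ] ∃[ r′ ] (p ++ (x ++ y ++ x) ++ r ≡ (X ++ Y ++ X) ++ r′ × length X ≡ length x × length Y ≡ length y)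
shift-to-block-start {s} p x y r p<6 6≤|x| 6∣|x| |y| conf
  with split-at-length x (length x ∸ length p) (sym (m∸n+n≡m p≤x))
     | split-at-length y (length y ∸ length p) (sym (m∸n+n≡m p≤y))
  where
  p≤x : length p ≤ length x
  p≤x = ≤-trans (<⇒≤ p<6) 6≤|x|
  p≤y : length p ≤ length y
  p≤y = ≤-trans p≤x (subst (length x ≤_) (sym |y|) (m≤m+n (length x) _))
... | x₁ , x₂ , refl , _ , |x₂| | y₁ , p′ , refl , _ , |p′| =
  p ++ x₁ , x₂ ++ y₁ , x₂ ++ r , shifted , |X| , |Y|
  where
  open ≡-Reasoning
  |X| : length (p ++ x₁) ≡ length x
  |X| = length-++-swap p x₁ (sym |x₂|)
  |Y| : length (x₂ ++ y₁) ≡ length (y₁ ++ p′)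
  |Y| = length-++-swap x₂ y₁ (trans |x₂| (sym |p′|))
  |p++x++y₁| : length (p ++ x ++ y₁) ≡ 4 * length x
  |p++x++y₁| = begin
    length (p ++ x ++ y₁)              ≡⟨ trans (length-++ p) (cong (λ n → length p + n) (length-++ x)) ⟩
    length p + (length x + length y₁)  ≡⟨ trans (+-comm (length p) _) (+-assoc (length x) _ _) ⟩
    length x + (length y₁ + length p)  ≡⟨ cong (λ n → length x + (length y₁ + n)) (sym |p′|) ⟩
    length x + (length y₁ + length p′) ≡⟨ cong (λ n → length x + n) (trans (sym (length-++ y₁)) |y|) ⟩
    4 * length x                       ∎
  regrouped : p ++ (x ++ (y₁ ++ p′) ++ x) ++ r ≡ p ++ (x ++ y₁) ++ p′ ++ x ++ r
  regrouped = solve (++-monoid Letter)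
  p′≡p : p′ ≡ p
  p′≡p = conforms-block-prefix-recurs p (x ++ y₁) p′ (x ++ r)
    (subst (24 ∣_) (sym |p++x++y₁|) (*-monoʳ-∣ 4 6∣|x|)) |p′| p<6
    (subst (Conforms (0F , s)) regrouped conf)
  realigned : p ++ (x ++ (y₁ ++ p) ++ x) ++ r ≡ ((p ++ x₁) ++ (x₂ ++ y₁) ++ (p ++ x₁)) ++ x₂ ++ r
  realigned = solve (++-monoid Letter)
  shifted : p ++ (x ++ (y₁ ++ p′) ++ x) ++ r ≡ ((p ++ x₁) ++ (x₂ ++ y₁) ++ (p ++ x₁)) ++ x₂ ++ r
  shifted = trans (cong (λ q → p ++ (x ++ (y₁ ++ q) ++ x) ++ r) p′≡p) realigned

pre5/4PowerFree-++ʳ : ∀ u {w} → Pre5/4PowerFree (u ++ w) → Pre5/4PowerFree w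
pre5/4PowerFree-++ʳ u pre-free v (p , s , w≡) = pre-free v (u ++ p , s , trans (cong (u ++_) w≡) (sym (++-assoc u p _)))

φ-5/4-power-in-first-block : ∀ {s} w p x y r → φ w ≡ p ++ (x ++ y ++ x) ++ r → Conforms (0F , s) (φ w) →
  length p < 6 → length y ≡ 3 * length x → 6 ≤ length x → ¬ Pre5/4PowerFree w
φ-5/4-power-in-first-block {s} w p x y r φw≡ conf₀ p<6 |y| 6≤|x| pre-free =
  let X , Y , r′ , shifted , |X| , |Y| = shift-to-block-start p x y r p<6 6≤|x| 6∣|x| |y| conf
      |Y|≡3|X| = trans |Y| (trans |y| (cong (3 *_) (sym |X|)))
      v , w′ , w≡ , φv≡ = φ-5/4-power-prefix-preimage w X Y r′ |Y|≡3|X| (subst (6 ∣_) (sym |X|) 6∣|x|) (trans φw≡ shifted)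
  in pre-free v ([] , w′ , w≡) (X , Y , subst (_≥ 1) (sym |X|) (≤-trans (s≤s z≤n) 6≤|x|) , |Y|≡3|X| , φv≡)
  where
  conf : Conforms (0F , s) (p ++ (x ++ y ++ x) ++ r)
  conf = subst (Conforms (0F , s)) φw≡ conf₀
  6∣|x| : 6 ∣ length x
  6∣|x| = conforming-5/4-power-6∣ x y |y| 6≤|x| (proj₁ (conforms-++⁻ (x ++ y ++ x) (proj₂ (conforms-++⁻ p conf))))

lemma4p5 : ∀ w → SubscriptIncreasing w → Pre5/4PowerFree w →
    ∀ z → Factor z (φ w) → Is5/4Power z → ¬ (length z ≥ 30)
lemma4p5 w si pre-free _ (p , r , φw≡) (x , y , _ , |y| , refl) 30≤|z|
  with φ-split-block-aligned w p _ φw≡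
... | u , w₁ , p′ , refl , φw₁≡ , p′<6
  with φ-conforms w₁ (subscriptIncreasing-++ʳ u si)
... | s , conf = φ-5/4-power-in-first-block w₁ p′ x y r φw₁≡ conf p′<6 |y| 6≤|x| (pre5/4PowerFree-++ʳ u pre-free)
  where
  6≤|x| : 6 ≤ length x
  6≤|x| = *-cancelˡ-≤ {6} {length x} 5 (subst (30 ≤_) (length-5/4-power x y |y|) 30≤|z|)
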